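{- For every integer $k \ge 6$, $$NTr(k) = NTr(k-1) + NTr(k-3) + NTr(k-4) + NTr(k-5),$$ where $NTr(k)$ denotes the number of non-tracking binary strings of length $k$.
   Context: Binary strings model radar observations: $1$ is a detection, $0$ a non-detection. A binary string $s = s_1 s_2 \cdots s_k$ produces a track (under the rule "3 out of 5 with loss 2") if there exist indices $i < j < l$ with $s_i = s_j = s_l = 1$, $l - i \le 4$, and no two consecutive zeros occurring among the positions strictly between $i$ and $l$. A string is non-tracking if it does not produce a track. For $k \ge 1$, $NTr(k)$ is the number of non-tracking binary strings of length $k$ (so $NTr(1)=2$, $NTr(2)=4$, $NTr(3)=7$, $NTr(4)=11$, $NTr(5)=18$). -}

module Defs where

open import Data.Bool using (Bool; true; false)
open import Data.Bool.Properties using () renaming (_≟_ to _≟ᵇ_)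
open import Data.Nat using (ℕ; zero; suc; _+_; _∸_; _≤_; _<_; _≤?_; _<?_)
open import Data.Fin using (Fin; toℕ)
open import Data.Fin.Properties using (any?; all?)
open import Data.Vec using (Vec; []; _∷_; lookup)
open import Data.List using (List; []; _∷_; map; _++_; filter; length)
open import Data.Product using (Σ; ∃; _×_; _,_)
open import Relation.Binary.PropositionalEquality using (_≡_)
open import Relation.Nullary using (¬_; Dec; yes; no)
open import Relation.Nullary.Decidable using (_×-dec_; _→-dec_; ¬?)

-- A binary string of length k: true = 1 (detection), false = 0 (non-detection).
-- Positions are indexed by Fin k (0-based; the shift is irrelevant).
BinStr : ℕ → Set
BinStr k = Vec Bool k

NoDoubleZeroBetween : ∀ {k} → BinStr k → Fin k → Fin k → Set
NoDoubleZeroBetween {k} s i l =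
  (m m' : Fin k) → toℕ m' ≡ suc (toℕ m) → toℕ i < toℕ m → toℕ m' < toℕ l →
  ¬ (lookup s m ≡ false × lookup s m' ≡ false)

-- The string produces a track under the rule "3 out of 5 with loss 2".
ProducesTrack : ∀ {k} → BinStr k → Set
ProducesTrack {k} s =
  Σ (Fin k) λ i → Σ (Fin k) λ j → Σ (Fin k) λ l →
    (toℕ i < toℕ j) × (toℕ j < toℕ l) ×
    (lookup s i ≡ true) × (lookup s j ≡ true) × (lookup s l ≡ true) ×
    (toℕ l ∸ toℕ i ≤ 4) ×
    NoDoubleZeroBetween s i l

NonTracking : ∀ {k} → BinStr k → Set
NonTracking s = ¬ ProducesTrack s

noDoubleZero? : ∀ {k} (s : BinStr k) (i l : Fin k) → Dec (NoDoubleZeroBetween s i l)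
noDoubleZero? s i l = all? λ m → all? λ m' →
  (toℕ m' Data.Nat.≟ suc (toℕ m)) →-dec ((toℕ i <? toℕ m) →-dec ((toℕ m' <? toℕ l) →-dec
     ¬? ((lookup s m ≟ᵇ false) ×-dec (lookup s m' ≟ᵇ false))))

producesTrack? : ∀ {k} (s : BinStr k) → Dec (ProducesTrack s)
producesTrack? s = any? λ i → any? λ j → any? λ l →
  (toℕ i <? toℕ j) ×-dec (toℕ j <? toℕ l) ×-dec
  (lookup s i ≟ᵇ true) ×-dec (lookup s j ≟ᵇ true) ×-dec (lookup s l ≟ᵇ true) ×-dec
  (toℕ l ∸ toℕ i ≤? 4) ×-dec noDoubleZero? s i l

allStrings : (k : ℕ) → List (BinStr k)
allStrings zero = [] ∷ []
allStrings (suc k) = map (true ∷_) (allStrings k) ++ map (false ∷_) (allStrings k)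

NTr : ℕ → ℕ
NTr k = length (filter (λ s → ¬? (producesTrack? s)) (allStrings k))

-- Split a string by its shortest prefix among 0, 100, 1100, 10100, 111, 1101, 1011, 10101;
-- these eight words form a complete prefix code, so every string of length at least 5 has
-- exactly one of them as a prefix.  The last four contain a track.  After each of the first
-- four no track can begin inside the prefix: it would have to jump over the final 00, or it
-- finds fewer than three detections before it.  Hence the strings with such a prefix p are
-- non-tracking exactly when the remaining suffix is, and they contribute NTr (k - |p|),
-- with |p| = 1, 3, 4, 5.
module Submission where

open import Defs
open import Data.Nat using (ℕ; _+_; _∸_; _≤_)
open import Relation.Binary.PropositionalEquality using (_≡_)

open import Level using (0ℓ)
open import Data.Bool using (Bool; true; false)
open import Data.Nat using (suc; pred; _<_; z≤n; s≤s)
open import Data.Nat.Solver using (module +-*-Solver)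
open import Data.Nat.Properties using (≤-trans)
open import Data.Fin using (Fin; toℕ) renaming (zero to fz; suc to fs)
open import Data.Vec using ([]; _∷_; _++_; lookup)
open import Data.List using (List; []; _∷_; map; filter; length) renaming (_++_ to _++ₗ_)
open import Data.List.Properties using (length-++; filter-++; filter-≐; filter-none)
open import Data.List.Relation.Unary.All using (universal)
open import Data.Product using (Σ; _×_; _,_)
open import Data.Sum using (_⊎_; inj₁; inj₂)
open import Data.Empty using (⊥-elim)
open import Function using (_∘_)
open import Relation.Nullary using (¬_; does)
open import Relation.Nullary.Decidable using (¬?)
open import Relation.Unary using (Pred; Decidable; _≐_)
open import Relation.Binary.PropositionalEquality using (refl; cong; cong₂; module ≡-Reasoning)

open ≡-Reasoning

length-filter-map : ∀ {A B : Set} {P : Pred B 0ℓ} (P? : Decidable P) (f : A → B) (xs : List A) →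
  length (filter P? (map f xs)) ≡ length (filter (P? ∘ f) xs)
length-filter-map P? f [] = refl
length-filter-map P? f (x ∷ xs) with does (P? (f x))
... | true  = cong suc (length-filter-map P? f xs)
... | false = length-filter-map P? f xs

-- Opaque so that conversion checking never unfolds the exhaustive searches of Defs.
opaque
  nonTracking? : ∀ {k} → Decidable (NonTracking {k})
  nonTracking? s = ¬? (producesTrack? s)

  count : (k : ℕ) {P : Pred (BinStr k) 0ℓ} → Decidable P → ℕ
  count k P? = length (filter P? (allStrings k))

  count-suc : ∀ k {P : Pred (BinStr (suc k)) 0ℓ} (P? : Decidable P) →
    count (suc k) P? ≡ count k (P? ∘ (true ∷_)) + count k (P? ∘ (false ∷_))
  count-suc k P? = begin
    length (filter P? (ones ++ₗ zeros))                  ≡⟨ cong length (filter-++ P? ones zeros) ⟩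
    length (filter P? ones ++ₗ filter P? zeros)          ≡⟨ length-++ (filter P? ones) ⟩
    length (filter P? ones) + length (filter P? zeros)   ≡⟨ cong₂ _+_ (length-filter-map P? (true ∷_) (allStrings k))
                                                                       (length-filter-map P? (false ∷_) (allStrings k)) ⟩
    count k (P? ∘ (true ∷_)) + count k (P? ∘ (false ∷_)) ∎
    where
    ones zeros : List (BinStr (suc k))
    ones  = map (true ∷_) (allStrings k)
    zeros = map (false ∷_) (allStrings k)

  count-≐ : ∀ k {P Q : Pred (BinStr k) 0ℓ} (P? : Decidable P) (Q? : Decidable Q) →
    P ≐ Q → count k P? ≡ count k Q?
  count-≐ k P? Q? P≐Q = cong length (filter-≐ P? Q? P≐Q (allStrings k))

  count-∅ : ∀ k {P : Pred (BinStr k) 0ℓ} (P? : Decidable P) → (∀ s → ¬ P s) → count k P? ≡ 0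
  count-∅ k P? ¬P = cong length (filter-none P? (universal ¬P (allStrings k)))

  NTr-count : ∀ k → NTr k ≡ count k nonTracking?
  NTr-count k = refl

track-cons : ∀ {k} (b : Bool) {s : BinStr k} → ProducesTrack s → ProducesTrack (b ∷ s)
track-cons b (i , j , l , i<j , j<l , sᵢ , sⱼ , sₗ , span , gap) =
  fs i , fs j , fs l , s≤s i<j , s≤s j<l , sᵢ , sⱼ , sₗ , span , gap′
  where
  gap′ : NoDoubleZeroBetween (b ∷ _) (fs i) (fs l)
  gap′ fz      _        _    ()        _
  gap′ (fs m) fz        ()   _         _
  gap′ (fs m) (fs m′)   m′≡  (s≤s i<m) (s≤s m′<l) = gap m m′ (cong pred m′≡) i<m m′<l

track-++ : ∀ {n k} (p : BinStr n) {s : BinStr k} → ProducesTrack s → ProducesTrack (p ++ s)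
track-++ []      t = t
track-++ (b ∷ p) t = track-cons b (track-++ p t)

TrackAtHead : ∀ {k} → BinStr (suc k) → Set
TrackAtHead {k} s = Σ (Fin (suc k)) λ j → Σ (Fin (suc k)) λ l →
  (0 < toℕ j) × (toℕ j < toℕ l) ×
  (lookup s fz ≡ true) × (lookup s j ≡ true) × (lookup s l ≡ true) ×
  (toℕ l ≤ 4) × NoDoubleZeroBetween s fz l

track-uncons : ∀ {k} (b : Bool) (s : BinStr k) → ProducesTrack (b ∷ s) → TrackAtHead (b ∷ s) ⊎ ProducesTrack s
track-uncons b s (fz , j , l , i<j , j<l , sᵢ , sⱼ , sₗ , span , gap) = inj₁ (j , l , i<j , j<l , sᵢ , sⱼ , sₗ , span , gap)
track-uncons b s (fs i , fz , l , () , _)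
track-uncons b s (fs i , fs j , fz , _ , () , _)
track-uncons b s (fs i , fs j , fs l , s≤s i<j , s≤s j<l , sᵢ , sⱼ , sₗ , span , gap) =
  inj₂ (i , j , l , i<j , j<l , sᵢ , sⱼ , sₗ , span ,
        λ m m′ m′≡ i<m m′<l → gap (fs m) (fs m′) (cong suc m′≡) (s≤s i<m) (s≤s m′<l))

track-uncons-¬head : ∀ {k} (b : Bool) (s : BinStr k) → ¬ TrackAtHead (b ∷ s) → ProducesTrack (b ∷ s) → ProducesTrack s
track-uncons-¬head b s ¬head t with track-uncons b s t
... | inj₁ head = ⊥-elim (¬head head)
... | inj₂ t′   = t′

Resetting : ∀ {n} → BinStr n → Set
Resetting p = ∀ {k} (s : BinStr k) → ProducesTrack (p ++ s) → ProducesTrack s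

TrackForcing : ∀ {n} → BinStr n → Set
TrackForcing p = ∀ {k} (s : BinStr k) → ProducesTrack (p ++ s)

resetting-0 : Resetting (false ∷ [])
resetting-0 s = track-uncons-¬head false s λ { (_ , _ , _ , _ , () , _) }

resetting-100 : Resetting (true ∷ false ∷ false ∷ [])
resetting-100 s = resetting-0 s ∘ resetting-0 (false ∷ s) ∘ track-uncons-¬head true _ ¬head
  where
  ¬head : ¬ TrackAtHead (true ∷ false ∷ false ∷ s)
  ¬head (fz , _ , () , _)
  ¬head (fs fz , _ , _ , _ , _ , () , _)
  ¬head (fs (fs fz) , _ , _ , _ , _ , () , _)
  ¬head (fs (fs (fs j)) , l , _ , j<l , _ , _ , _ , _ , gap) =
    gap (fs fz) (fs (fs fz)) refl (s≤s z≤n) (≤-trans (s≤s (s≤s (s≤s z≤n))) j<l) (refl , refl)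

resetting-1100 : Resetting (true ∷ true ∷ false ∷ false ∷ [])
resetting-1100 s = resetting-100 s ∘ track-uncons-¬head true _ ¬head
  where
  ¬head : ¬ TrackAtHead (true ∷ true ∷ false ∷ false ∷ s)
  ¬head (_ , fz , _ , () , _)
  ¬head (fz , fs fz , () , _)
  ¬head (fs j , fs fz , _ , s≤s () , _)
  ¬head (_ , fs (fs fz) , _ , _ , _ , _ , () , _)
  ¬head (_ , fs (fs (fs fz)) , _ , _ , _ , _ , () , _)
  ¬head (_ , fs (fs (fs (fs l))) , _ , _ , _ , _ , _ , _ , gap) =
    gap (fs (fs fz)) (fs (fs (fs fz))) refl (s≤s z≤n) (s≤s (s≤s (s≤s (s≤s z≤n)))) (refl , refl)

resetting-10100 : Resetting (true ∷ false ∷ true ∷ false ∷ false ∷ [])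
resetting-10100 s = resetting-100 s ∘ resetting-0 _ ∘ track-uncons-¬head true _ ¬head
  where
  ¬head : ¬ TrackAtHead (true ∷ false ∷ true ∷ false ∷ false ∷ s)
  ¬head (_ , fz , _ , () , _)
  ¬head (fz , fs l , () , _)
  ¬head (fs fz , fs l , _ , _ , _ , () , _)
  ¬head (fs (fs j) , fs fz , _ , s≤s () , _)
  ¬head (fs (fs j) , fs (fs fz) , _ , s≤s (s≤s ()) , _)
  ¬head (_ , fs (fs (fs fz)) , _ , _ , _ , _ , () , _)
  ¬head (_ , fs (fs (fs (fs fz))) , _ , _ , _ , _ , () , _)
  ¬head (_ , fs (fs (fs (fs (fs l)))) , _ , _ , _ , _ , _ , s≤s (s≤s (s≤s (s≤s ()))) , _)

forcing-111 : TrackForcing (true ∷ true ∷ true ∷ [])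
forcing-111 s = fz , fs fz , fs (fs fz) , s≤s z≤n , s≤s (s≤s z≤n) , refl , refl , refl , s≤s (s≤s z≤n) , gap
  where
  gap : NoDoubleZeroBetween (true ∷ true ∷ true ∷ s) fz (fs (fs fz))
  gap fz      _                _   () _
  gap (fs m) fz                ()  _ _
  gap (fs m) (fs fz)           ()  _ _
  gap (fs m) (fs (fs m′))      _   _ (s≤s (s≤s ()))

forcing-1101 : TrackForcing (true ∷ true ∷ false ∷ true ∷ [])
forcing-1101 s = fz , fs fz , fs (fs (fs fz)) , s≤s z≤n , s≤s (s≤s z≤n) , refl , refl , refl , s≤s (s≤s (s≤s z≤n)) , gap
  where
  gap : NoDoubleZeroBetween (true ∷ true ∷ false ∷ true ∷ s) fz (fs (fs (fs fz)))
  gap fz           _                    _   () _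
  gap (fs fz)      _                    _   _ _ (() , _)
  gap (fs (fs m)) fz                    ()  _ _
  gap (fs (fs m)) (fs fz)               ()  _ _
  gap (fs (fs m)) (fs (fs fz))          ()  _ _
  gap (fs (fs m)) (fs (fs (fs m′)))     _   _ (s≤s (s≤s (s≤s ())))

forcing-1011 : TrackForcing (true ∷ false ∷ true ∷ true ∷ [])
forcing-1011 s = fz , fs (fs fz) , fs (fs (fs fz)) , s≤s z≤n , s≤s (s≤s (s≤s z≤n)) , refl , refl , refl , s≤s (s≤s (s≤s z≤n)) , gap
  where
  gap : NoDoubleZeroBetween (true ∷ false ∷ true ∷ true ∷ s) fz (fs (fs (fs fz)))
  gap fz           _                    _   () _
  gap (fs fz)      (fs (fs fz))         _   _ _ (_ , ())
  gap (fs fz)      fz                   ()  _ _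
  gap (fs fz)      (fs fz)              ()  _ _
  gap (fs fz)      (fs (fs (fs m′)))    ()  _ _
  gap (fs (fs m)) fz                    ()  _ _
  gap (fs (fs m)) (fs fz)               ()  _ _
  gap (fs (fs m)) (fs (fs fz))          ()  _ _
  gap (fs (fs m)) (fs (fs (fs m′)))     _   _ (s≤s (s≤s (s≤s ())))

forcing-10101 : TrackForcing (true ∷ false ∷ true ∷ false ∷ true ∷ [])
forcing-10101 s = fz , fs (fs fz) , fs (fs (fs (fs fz))) , s≤s z≤n , s≤s (s≤s (s≤s z≤n)) , refl , refl , refl , s≤s (s≤s (s≤s (s≤s z≤n))) , gap
  where
  gap : NoDoubleZeroBetween (true ∷ false ∷ true ∷ false ∷ true ∷ s) fz (fs (fs (fs (fs fz))))
  gap fz                _                         _   () _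
  gap (fs fz)           (fs (fs fz))              _   _ _ (_ , ())
  gap (fs fz)           fz                        ()  _ _
  gap (fs fz)           (fs fz)                   ()  _ _
  gap (fs fz)           (fs (fs (fs m′)))         ()  _ _
  gap (fs (fs fz))      _                         _   _ _ (() , _)
  gap (fs (fs (fs m))) fz                         ()  _ _
  gap (fs (fs (fs m))) (fs fz)                    ()  _ _
  gap (fs (fs (fs m))) (fs (fs fz))               ()  _ _
  gap (fs (fs (fs m))) (fs (fs (fs fz)))          ()  _ _
  gap (fs (fs (fs m))) (fs (fs (fs (fs m′))))     _   _ (s≤s (s≤s (s≤s (s≤s ()))))

NTrAfter : ∀ {n} → BinStr n → ℕ → ℕ
NTrAfter p k = count k (λ s → nonTracking? (p ++ s))

NTrAfter-resetting : ∀ {n} {p : BinStr n} → Resetting p → ∀ k → NTrAfter p k ≡ NTr k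
NTrAfter-resetting {p = p} reset k = begin
  NTrAfter p k
    ≡⟨ count-≐ k (λ s → nonTracking? (p ++ s)) nonTracking?
         ((λ ¬track track → ¬track (track-++ p track)) , (λ ¬track track → ¬track (reset _ track))) ⟩
  count k nonTracking?
    ≡⟨ NTr-count k ⟨
  NTr k ∎

NTrAfter-forcing : ∀ {n} {p : BinStr n} → TrackForcing p → ∀ k → NTrAfter p k ≡ 0
NTrAfter-forcing {p = p} force k = count-∅ k (λ s → nonTracking? (p ++ s)) (λ s ¬track → ¬track (force s))

NTrAfter-11 : ∀ k → NTrAfter (true ∷ true ∷ []) (2 + k) ≡ NTr k
NTrAfter-11 k = begin
  NTrAfter (true ∷ true ∷ []) (2 + k)
    ≡⟨ count-suc (1 + k) _ ⟩
  NTrAfter (true ∷ true ∷ true ∷ []) (1 + k) + NTrAfter (true ∷ true ∷ false ∷ []) (1 + k)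
    ≡⟨ cong₂ _+_ (NTrAfter-forcing forcing-111 (1 + k)) (count-suc k _) ⟩
  NTrAfter (true ∷ true ∷ false ∷ true ∷ []) k + NTrAfter (true ∷ true ∷ false ∷ false ∷ []) k
    ≡⟨ cong₂ _+_ (NTrAfter-forcing forcing-1101 k) (NTrAfter-resetting resetting-1100 k) ⟩
  NTr k ∎

NTrAfter-10 : ∀ k → NTrAfter (true ∷ false ∷ []) (3 + k) ≡ NTr k + NTr (2 + k)
NTrAfter-10 k = begin
  NTrAfter (true ∷ false ∷ []) (3 + k)
    ≡⟨ count-suc (2 + k) _ ⟩
  NTrAfter (true ∷ false ∷ true ∷ []) (2 + k) + NTrAfter (true ∷ false ∷ false ∷ []) (2 + k)
    ≡⟨ cong₂ _+_ (count-suc (1 + k) _) (NTrAfter-resetting resetting-100 (2 + k)) ⟩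
  NTrAfter (true ∷ false ∷ true ∷ true ∷ []) (1 + k) + NTrAfter (true ∷ false ∷ true ∷ false ∷ []) (1 + k) + NTr (2 + k)
    ≡⟨ cong (_+ NTr (2 + k)) (cong₂ _+_ (NTrAfter-forcing forcing-1011 (1 + k)) (count-suc k _)) ⟩
  NTrAfter (true ∷ false ∷ true ∷ false ∷ true ∷ []) k + NTrAfter (true ∷ false ∷ true ∷ false ∷ false ∷ []) k + NTr (2 + k)
    ≡⟨ cong (_+ NTr (2 + k)) (cong₂ _+_ (NTrAfter-forcing forcing-10101 k) (NTrAfter-resetting resetting-10100 k)) ⟩
  NTr k + NTr (2 + k) ∎

NTr-recurrence : ∀ k → NTr (6 + k) ≡ NTr (5 + k) + NTr (3 + k) + NTr (2 + k) + NTr (1 + k)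
NTr-recurrence k = begin
  NTr (6 + k)
    ≡⟨ NTr-count (6 + k) ⟩
  count (6 + k) nonTracking?
    ≡⟨ count-suc (5 + k) nonTracking? ⟩
  NTrAfter (true ∷ []) (5 + k) + NTrAfter (false ∷ []) (5 + k)
    ≡⟨ cong₂ _+_ (count-suc (4 + k) _) (NTrAfter-resetting resetting-0 (5 + k)) ⟩
  NTrAfter (true ∷ true ∷ []) (4 + k) + NTrAfter (true ∷ false ∷ []) (4 + k) + NTr (5 + k)
    ≡⟨ cong (_+ NTr (5 + k)) (cong₂ _+_ (NTrAfter-11 (2 + k)) (NTrAfter-10 (1 + k))) ⟩
  NTr (2 + k) + (NTr (1 + k) + NTr (3 + k)) + NTr (5 + k)
    ≡⟨ solve 4 (λ a b c d → c :+ (d :+ b) :+ a := a :+ b :+ c :+ d) refl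
               (NTr (5 + k)) (NTr (3 + k)) (NTr (2 + k)) (NTr (1 + k)) ⟩
  NTr (5 + k) + NTr (3 + k) + NTr (2 + k) + NTr (1 + k) ∎
  where open +-*-Solver

lemma1 : (k : ℕ) → 6 ≤ k →
    NTr k ≡ NTr (k ∸ 1) + NTr (k ∸ 3) + NTr (k ∸ 4) + NTr (k ∸ 5)
lemma1 .(6 + k) (s≤s (s≤s (s≤s (s≤s (s≤s (s≤s {n = k} z≤n)))))) = NTr-recurrence k
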